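{- Let $3$-Sudoku number $sn(G,3)$ be as defined in the context. Then: (i) for the path $P_n$ on $n$ vertices, $sn(P_n,3)=\lceil \frac{n+1}{2}\rceil$; (ii) for the even cycle $C_{2n}$ with $n\ge 2$, $sn(C_{2n},3)=n$; (iii) for the star $K_{1,n}$ with $n\ge 2$, $sn(K_{1,n},3)=n$; (iv) for the complete bipartite graph $K_{m,n}$ with $2\le m\le n$, $sn(K_{m,n},3)=m$; (v) for the bistar $B_{m,n}$, $sn(B_{m,n},3)=m+n$, except when $m=n=1$, in which case $sn(B_{1,1},3)=3$.
   Context: All graphs are finite, simple, undirected and connected. Let $G=(V,E)$ be a graph with chromatic number $\chi(G)$, let $k\ge\chi(G)$ and $S\subseteq V$. A proper $k$-coloring $C_0$ of the induced subgraph $G[S]$ (using colors from a fixed set of $k$ colors) is extendable if it extends to a proper $k$-coloring of $G$, and is a $k$-Sudoku coloring of $G$ if it extends to exactly one proper $k$-coloring of $G$. The $k$-Sudoku number $sn(G,k)$ is the smallest $|S|$ such that $G[S]$ admits a $k$-Sudoku coloring; $sn(G)=sn(G,\chi(G))$. The bistar $B_{m,n}$ is obtained by joining the centers of the stars $K_{1,m}$ and $K_{1,n}$ by an edge. -}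

module Defs where

open import Data.Nat using (ℕ; zero; suc; _+_; _∸_; _≤_; _<_)
open import Data.Fin using (Fin; toℕ)
import Data.Fin as F
open import Data.Maybe using (Maybe; just; nothing; is-just)
open import Data.Bool using (if_then_else_)
open import Data.Product using (Σ; _×_; _,_; ∃)
open import Data.Sum using (_⊎_)
open import Relation.Binary.PropositionalEquality using (_≡_; _≢_)

-- A graph on the vertex set Fin n, given by its (symmetric, irreflexive) adjacency relation.
Graph : ℕ → Set₁
Graph n = Fin n → Fin n → Set

fromRel : (n : ℕ) → (ℕ → ℕ → Set) → Graph n
fromRel n E i j = E (toℕ i) (toℕ j) ⊎ E (toℕ j) (toℕ i)

pathE : ℕ → ℕ → Set
pathE i j = j ≡ suc i

Path : (n : ℕ) → Graph n
Path n = fromRel n pathE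

cycleE : ℕ → ℕ → ℕ → Set
cycleE m i j = (j ≡ suc i) ⊎ ((i ≡ m ∸ 1) × (j ≡ 0))

Cycle : (m : ℕ) → Graph m
Cycle m = fromRel m (cycleE m)

starE : ℕ → ℕ → Set
starE i j = (i ≡ 0) × (1 ≤ j)

Star : (n : ℕ) → Graph (suc n)
Star n = fromRel (suc n) starE

bipE : ℕ → ℕ → ℕ → Set
bipE m i j = (i < m) × (m ≤ j)

CompleteBipartite : (m n : ℕ) → Graph (m + n)
CompleteBipartite m n = fromRel (m + n) (bipE m)

-- Bistar B_{m,n} : centers 0 and 1 (adjacent); leaves 2..m+1 attached to 0,
-- leaves m+2..m+n+1 attached to 1.
bistarE : ℕ → ℕ → ℕ → Set
bistarE m i j =
  ((i ≡ 0) × (j ≡ 1))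
  ⊎ (((i ≡ 0) × ((2 ≤ j) × (j < 2 + m)))
  ⊎ ((i ≡ 1) × (2 + m ≤ j)))

Bistar : (m n : ℕ) → Graph (2 + m + n)
Bistar m n = fromRel (2 + m + n) (bistarE m)

IsProperColoring : ∀ {n} (G : Graph n) (k : ℕ) → (Fin n → Fin k) → Set
IsProperColoring {n} G k c = ∀ (u v : Fin n) → G u v → c u ≢ c v

-- Partial coloring: a coloring C0 of G[S], where S = {v | p v ≡ just _}.
PartialColoring : ℕ → ℕ → Set
PartialColoring n k = Fin n → Maybe (Fin k)

domSize : ∀ {n k} → PartialColoring n k → ℕ
domSize {zero} p = 0
domSize {suc n} p = (if is-just (p F.zero) then 1 else 0) + domSize (λ i → p (F.suc i))

IsProperPartial : ∀ {n} (G : Graph n) (k : ℕ) → PartialColoring n k → Set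
IsProperPartial {n} G k p =
  ∀ (u v : Fin n) (a b : Fin k) → G u v → p u ≡ just a → p v ≡ just b → a ≢ b

Extends : ∀ {n k} → (Fin n → Fin k) → PartialColoring n k → Set
Extends {n} {k} c p = ∀ (v : Fin n) (a : Fin k) → p v ≡ just a → c v ≡ a

IsSudokuColoring : ∀ {n} (G : Graph n) (k : ℕ) → PartialColoring n k → Set
IsSudokuColoring {n} G k p =
  Σ (Fin n → Fin k) λ c →
    (IsProperColoring G k c × Extends c p)
    × (∀ (c' : Fin n → Fin k) → IsProperColoring G k c' → Extends c' p →
         ∀ (v : Fin n) → c' v ≡ c v)

IsSudokuNumber : ∀ {n} (G : Graph n) (k : ℕ) → ℕ → Set
IsSudokuNumber {n} G k s =
  (Σ (PartialColoring n k) λ p →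
     (IsProperPartial G k p × IsSudokuColoring G k p) × (domSize p ≡ s))
  × (∀ (p : PartialColoring n k) → IsProperPartial G k p →
       IsSudokuColoring G k p → s ≤ domSize p)

{-# OPTIONS --safe #-}
-- If an uncoloured vertex v of a Sudoku colouring c missed a colour a ≠ c v on its neighbours,
-- recolouring v with a would give a second extension, so v sees both other colours. Hence v has
-- two neighbours; two uncoloured vertices cannot have completely joined neighbourhoods (the colour
-- different from both of theirs would appear on two adjacent neighbours); and two adjacent
-- uncoloured vertices of degree at most two could swap their colours. So leaves and path ends are
-- coloured, no two consecutive vertices of a path or cycle are uncoloured, and one side of K_{m,n}
-- is fully coloured; counting gives the lower bounds. In the precolourings realising them every
-- uncoloured vertex has two precoloured neighbours of distinct colours and so is forced to take the
-- third colour; in B_{m,n} one centre is forced by its leaves and the other centre then by it and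
-- a leaf.
module Submission where

open import Defs
open import Data.Nat using (ℕ; zero; suc; _+_; _∸_; _≤_; _<_; _≮_; z≤n; s≤s; ⌈_/2⌉; ⌊_/2⌋)
open import Data.Nat.Properties
  using (_≟_; _<?_; ≤-refl; ≤-reflexive; ≤-trans; ≤-antisym; ≤-pred; <-trans; <-irrefl; <⇒≤;
         ≤⇒≯; ≰⇒>; ≮⇒≥; ≤∧≢⇒<; n≤1+n; n<1+n; suc-injective; +-comm; +-suc; m≤m+n; m≤n+m; m<m+n;
         +-mono-≤; +-monoʳ-≤; +-mono-<; +-mono-≤-<; +-∸-assoc; n∸n≡0; m+n∸n≡m; m≤n+m∸n;
         ⌊n/2⌋-mono; ⌈n/2⌉-mono; n≡⌊n+n/2⌋; n≡⌈n+n/2⌉; module ≤-Reasoning)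
open import Data.Fin using (Fin; toℕ) renaming (zero to fzero; suc to fsuc)
open import Data.Fin.Properties using (toℕ-injective; toℕ-fromℕ<; toℕ<n; all?; any?)
  renaming (_≟_ to _≟ᶠ_)
open import Data.Vec.Functional using (tail; updateAt)
open import Data.Vec.Functional.Properties using (updateAt-updates; updateAt-minimal)
open import Data.Maybe using (Maybe; just; nothing)
open import Data.Maybe.Properties using (just-injective; ≡-dec)
open import Data.Bool using (Bool; true; false; if_then_else_; T)
open import Data.Product using (_×_; _,_; proj₁; proj₂; ∃)
open import Data.Sum using (_⊎_; inj₁; inj₂)
open import Data.Empty using (⊥; ⊥-elim)
open import Function using (_∘_; const; case_of_)
open import Relation.Binary.PropositionalEquality
open import Relation.Nullary using (¬_; Dec; yes; no; does; ¬?; contradiction)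
open import Relation.Nullary.Decidable using (from-yes; _→-dec_; _⊎-dec_; _×-dec_; T?)
open import Relation.Unary using (Decidable)

private
  variable
    N k : ℕ

pattern c0 = fzero
pattern c1 = fsuc fzero
pattern c2 = fsuc (fsuc fzero)

other : Fin 3 → Fin 3 → Fin 3
other c0 c0 = c1
other c0 c1 = c2
other c0 c2 = c1
other c1 c0 = c2
other c1 c1 = c0
other c1 c2 = c0
other c2 c0 = c1
other c2 c1 = c0
other c2 c2 = c0

other≢ˡ : ∀ a b → other a b ≢ a
other≢ˡ = from-yes (all? λ a → all? λ b → ¬? (other a b ≟ᶠ a))

other≢ʳ : ∀ a b → other a b ≢ b
other≢ʳ = from-yes (all? λ a → all? λ b → ¬? (other a b ≟ᶠ b))

other-unique : ∀ x a b → x ≢ a → x ≢ b → a ≢ b → x ≡ other a b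
other-unique = from-yes (all? λ x → all? λ a → all? λ b →
  ¬? (x ≟ᶠ a) →-dec ¬? (x ≟ᶠ b) →-dec ¬? (a ≟ᶠ b) →-dec x ≟ᶠ other a b)

c0-then : Fin 3 → ℕ → Fin 3
c0-then x zero    = c0
c0-then x (suc _) = x

c0-then-≢ : ∀ {x y} i → c0 ≢ y → x ≢ y → c0-then x i ≢ y
c0-then-≢ zero    c0≢y _   = c0≢y
c0-then-≢ (suc _) _    x≢y = x≢y

Adj : Graph N → Fin N → Fin N → Set
Adj G u v = G u v ⊎ G v u

proper-adj : ∀ {G : Graph N} {c : Fin N → Fin k} → IsProperColoring G k c →
             ∀ {u v} → Adj G u v → c u ≢ c v
proper-adj proper (inj₁ e) = proper _ _ e
proper-adj proper (inj₂ e) = proper _ _ e ∘ sym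

AtMostOneNeighbour : Graph N → Fin N → Set
AtMostOneNeighbour G u = ∀ {x y} → Adj G u x → Adj G u y → x ≡ y

AtMostTwoNeighbours : Graph N → Fin N → Set
AtMostTwoNeighbours G u =
  ∀ {x y z} → Adj G u x → Adj G u y → Adj G u z → x ≡ y ⊎ x ≡ z ⊎ y ≡ z

atMostOneNeighbour : ∀ {G : Graph N} {u} ℓ → (∀ {z} → Adj G u z → toℕ z ≡ ℓ) →
                     AtMostOneNeighbour G u
atMostOneNeighbour ℓ label ux uy = toℕ-injective (trans (label ux) (sym (label uy)))

atMostTwoNeighbours : ∀ {G : Graph N} {u} (P Q : Fin N → Set) →
                      (∀ {z} → Adj G u z → P z ⊎ Q z) →
                      (∀ {x y} → P x → P y → x ≡ y) → (∀ {x y} → Q x → Q y → x ≡ y) →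
                      AtMostTwoNeighbours G u
atMostTwoNeighbours P Q side P-unique Q-unique ux uy uz with side ux | side uy | side uz
... | inj₁ px | inj₁ py | _       = inj₁ (P-unique px py)
... | inj₂ qx | inj₂ qy | _       = inj₁ (Q-unique qx qy)
... | inj₁ px | inj₂ _  | inj₁ pz = inj₂ (inj₁ (P-unique px pz))
... | inj₂ qx | inj₁ _  | inj₂ qz = inj₂ (inj₁ (Q-unique qx qz))
... | inj₁ _  | inj₂ qy | inj₂ qz = inj₂ (inj₂ (Q-unique qy qz))
... | inj₂ _  | inj₁ py | inj₁ pz = inj₂ (inj₂ (P-unique py pz))

atMostTwoNeighbours-byLabels : ∀ {G : Graph N} {u} a b →
                               (∀ {z} → Adj G u z → toℕ z ≡ a ⊎ toℕ z ≡ b) → AtMostTwoNeighbours G u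
atMostTwoNeighbours-byLabels {G = G} a b labels =
  atMostTwoNeighbours {G = G} (λ z → toℕ z ≡ a) (λ z → toℕ z ≡ b) labels same-label same-label
  where
  same-label : ∀ {ℓ x y} → toℕ x ≡ ℓ → toℕ y ≡ ℓ → x ≡ y
  same-label x≡ℓ y≡ℓ = toℕ-injective (trans x≡ℓ (sym y≡ℓ))

module _ {E : ℕ → ℕ → Set} where

  adj-fromRel : ∀ {u v : Fin N} → Adj (fromRel N E) u v → fromRel N E u v
  adj-fromRel (inj₁ e)        = e
  adj-fromRel (inj₂ (inj₁ e)) = inj₂ e
  adj-fromRel (inj₂ (inj₂ e)) = inj₁ e

  fromRel-proper : ∀ {f : ℕ → Fin k} → (∀ {i j} → E i j → f i ≢ f j) →
                   IsProperColoring (fromRel N E) k (f ∘ toℕ)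
  fromRel-proper proper u v (inj₁ e) = proper e
  fromRel-proper proper u v (inj₂ e) = proper e ∘ sym

-- Stated with does rather than by with-abstraction, so that restricting a shifted predicate
-- reduces definitionally; the counting lemmas below rely on this.
restrict : {P : Fin N → Set} → Decidable P → (Fin N → Fin k) → PartialColoring N k
restrict P? c v = if does (P? v) then just (c v) else nothing

module _ {P : Fin N → Set} (P? : Decidable P) (c : Fin N → Fin k) where

  restrict-∈ : ∀ {v} → P v → restrict P? c v ≡ just (c v)
  restrict-∈ {v} v∈ with P? v
  ... | yes _  = refl
  ... | no v∉ = contradiction v∈ v∉

  restrict-extends : Extends c (restrict P? c)
  restrict-extends v a eq with P? v
  ... | yes _ = just-injective eq
  ... | no _  with () ← eq

free? : (x : Maybe (Fin k)) → Dec (x ≡ nothing)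
free? x = ≡-dec _≟ᶠ_ x nothing

domSize-coloured-head : (p : PartialColoring (suc N) k) → p fzero ≢ nothing →
                        domSize p ≡ suc (domSize (tail p))
domSize-coloured-head p coloured with p fzero
... | just _  = refl
... | nothing = contradiction refl coloured

domSize-free-head : (p : PartialColoring (suc N) k) → p fzero ≡ nothing →
                    domSize p ≡ domSize (tail p)
domSize-free-head p free rewrite free = refl

domSize-mono : (p q : PartialColoring N k) → (∀ i → p i ≢ nothing → q i ≢ nothing) →
               domSize p ≤ domSize q
domSize-mono {zero}  p q sub = z≤n
domSize-mono {suc N} p q sub with free? (p fzero)
... | yes free = begin
  domSize p          ≡⟨ domSize-free-head p free ⟩
  domSize (tail p)   ≤⟨ domSize-mono (tail p) (tail q) (sub ∘ fsuc) ⟩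
  domSize (tail q)   ≤⟨ m≤n+m _ _ ⟩
  domSize q          ∎
  where open ≤-Reasoning
... | no coloured = begin
  domSize p                ≡⟨ domSize-coloured-head p coloured ⟩
  suc (domSize (tail p))   ≤⟨ s≤s (domSize-mono (tail p) (tail q) (sub ∘ fsuc)) ⟩
  suc (domSize (tail q))   ≡⟨ domSize-coloured-head q (sub fzero coloured) ⟨
  domSize q                ∎
  where open ≤-Reasoning

restrict-≤-domSize : ∀ {P : Fin N → Set} (P? : Decidable P) c (q : PartialColoring N k) →
                     (∀ v → P v → q v ≢ nothing) → domSize (restrict P? c) ≤ domSize q
restrict-≤-domSize P? c q coloured = domSize-mono _ q sub
  where
  sub : ∀ v → restrict P? c v ≢ nothing → q v ≢ nothing
  sub v restricted with P? v
  ... | yes v∈ = coloured v v∈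
  ... | no _   = contradiction refl restricted

domSize-total : (c : Fin N → Fin k) → domSize (just ∘ c) ≡ N
domSize-total {zero}  c = refl
domSize-total {suc N} c = cong suc (domSize-total (tail c))

domSize-empty : domSize {N} {k} (const nothing) ≡ 0
domSize-empty {zero}  = refl
domSize-empty {suc N} = domSize-empty {N}

Below? : ∀ m → Decidable {A = Fin N} (λ v → toℕ v < m)
Below? m v = toℕ v <? m

NotBelow? : ∀ m → Decidable {A = Fin N} (λ v → toℕ v ≮ m)
NotBelow? m v = ¬? (toℕ v <? m)

domSize-restrict-Below : ∀ m {n} (c : Fin (m + n) → Fin k) → domSize (restrict (Below? m) c) ≡ m
domSize-restrict-Below zero    {n} c = domSize-empty {n}
domSize-restrict-Below (suc m)     c = cong suc (domSize-restrict-Below m (tail c))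

domSize-restrict-NotBelow : ∀ m {n} (c : Fin (m + n) → Fin k) →
                            domSize (restrict (NotBelow? m) c) ≡ n
domSize-restrict-NotBelow zero    c = domSize-total c
domSize-restrict-NotBelow (suc m) c = domSize-restrict-NotBelow m (tail c)

NoConsecutiveFree : PartialColoring N k → Set
NoConsecutiveFree p = ∀ {i j} → toℕ j ≡ suc (toℕ i) → p i ≡ nothing → p j ≡ nothing → ⊥

LastColoured : PartialColoring N k → Set
LastColoured {N} p = ∀ i → suc (toℕ i) ≡ N → p i ≢ nothing

module _ {p : PartialColoring (suc N) k} where

  tail-noConsecutiveFree : NoConsecutiveFree p → NoConsecutiveFree (tail p)
  tail-noConsecutiveFree no-free-pair j≡1+i = no-free-pair (cong suc j≡1+i)

  tail-lastColoured : LastColoured p → LastColoured (tail p)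
  tail-lastColoured last i = last (fsuc i) ∘ cong suc

domSize-twoStep : ∀ {b} (p : PartialColoring (suc (suc N)) k) → NoConsecutiveFree p →
                  b ≤ suc (domSize (tail p)) → b ≤ suc (domSize (tail (tail p))) → b ≤ domSize p
domSize-twoStep p no-free-pair b≤₁ b≤₂ with free? (p fzero)
... | no coloured = ≤-trans b≤₁ (≤-reflexive (sym (domSize-coloured-head p coloured)))
... | yes free    = ≤-trans b≤₂ (≤-reflexive (sym (begin
  domSize p                     ≡⟨ domSize-free-head p free ⟩
  domSize (tail p)              ≡⟨ domSize-coloured-head (tail p) (no-free-pair refl free) ⟩
  suc (domSize (tail (tail p))) ∎)))
  where open ≡-Reasoning

⌊/2⌋≤domSize : ∀ N (p : PartialColoring N k) → NoConsecutiveFree p → ⌊ N /2⌋ ≤ domSize p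
⌊/2⌋≤domSize zero          p _ = z≤n
⌊/2⌋≤domSize (suc zero)    p _ = z≤n
⌊/2⌋≤domSize (suc (suc N)) p no-free-pair = domSize-twoStep p no-free-pair
  (s≤s (≤-trans (⌊n/2⌋-mono (n≤1+n N)) (⌊/2⌋≤domSize (suc N) (tail p) nfp₁)))
  (s≤s (⌊/2⌋≤domSize N (tail (tail p)) (tail-noConsecutiveFree nfp₁)))
  where
  nfp₁ : NoConsecutiveFree (tail p)
  nfp₁ = tail-noConsecutiveFree no-free-pair

⌈/2⌉≤domSize : ∀ N (p : PartialColoring N k) → NoConsecutiveFree p → LastColoured p →
               ⌈ N /2⌉ ≤ domSize p
⌈/2⌉≤domSize zero          p _ _ = z≤n
⌈/2⌉≤domSize (suc zero)    p _ last = ≤-reflexive (sym (domSize-coloured-head p (last fzero refl)))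
⌈/2⌉≤domSize (suc (suc N)) p no-free-pair last = domSize-twoStep p no-free-pair
  (s≤s (≤-trans (⌈n/2⌉-mono (n≤1+n N)) (⌈/2⌉≤domSize (suc N) (tail p) nfp₁ last₁)))
  (s≤s (⌈/2⌉≤domSize N (tail (tail p)) (tail-noConsecutiveFree nfp₁) (tail-lastColoured last₁)))
  where
  nfp₁ : NoConsecutiveFree (tail p)
  nfp₁ = tail-noConsecutiveFree no-free-pair
  last₁ : LastColoured (tail p)
  last₁ = tail-lastColoured last

-- Forced vertices

Determines : Graph N → (k : ℕ) → PartialColoring N k → (Fin N → Fin k) → Set
Determines {N} G k p c =
  ∀ (c' : Fin N → Fin k) → IsProperColoring G k c' → Extends c' p → ∀ v → c' v ≡ c v

isSudokuNumber : ∀ {G : Graph N} {p c s} → IsProperColoring G k c → Extends c p →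
                 Determines G k p c → domSize p ≡ s →
                 (∀ q → IsSudokuColoring G k q → s ≤ domSize q) → IsSudokuNumber G k s
isSudokuNumber {p = p} proper extends determines size lower =
  (p , (properPartial , (_ , (proper , extends) , determines)) , size) , λ q _ → lower q
  where
  properPartial : IsProperPartial _ _ p
  properPartial u v a b e pu pv a≡b =
    proper u v e (trans (extends u a pu) (trans a≡b (sym (extends v b pv))))

record Forced (G : Graph N) (P : Fin N → Set) (c : Fin N → Fin 3) (v : Fin N) : Set where
  constructor forced
  field
    {left right} : Fin N
    left-adj     : Adj G v left
    right-adj    : Adj G v right
    left-∈       : P left
    right-∈      : P right
    distinct     : c left ≢ c right

forced-agree : ∀ {G : Graph N} {P c c' v} →
               IsProperColoring G 3 c → IsProperColoring G 3 c' →
               (∀ {u} → P u → c' u ≡ c u) → Forced G P c v → c' v ≡ c v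
forced-agree {G = G} {P} {c} {c'} {v} c-proper c'-proper agree (forced vl vr l∈ r∈ l≢r) =
  trans (other-unique (c' v) _ _ (avoids vl l∈) (avoids vr r∈) l≢r)
        (sym (other-unique (c v) _ _ (proper-adj c-proper vl) (proper-adj c-proper vr) l≢r))
  where
  avoids : ∀ {u} → Adj G v u → P u → c' v ≢ c u
  avoids vu u∈ eq = proper-adj c'-proper vu (trans eq (sym (agree u∈)))

forcedByLabels : ∀ {E : ℕ → ℕ → Set} {Q : ℕ → Set} {f : ℕ → Fin 3} {v : Fin N} {i j} →
                 (i<N : i < N) (j<N : j < N) →
                 E (toℕ v) i ⊎ E i (toℕ v) → E (toℕ v) j ⊎ E j (toℕ v) → Q i → Q j → f i ≢ f j →
                 Forced (fromRel N E) (Q ∘ toℕ) (f ∘ toℕ) v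
forcedByLabels {E = E} {Q} {f} {v} i<N j<N vi vj qi qj fi≢fj =
  forced (adj (toℕ-fromℕ< i<N) vi) (adj (toℕ-fromℕ< j<N) vj)
         (subst Q (sym (toℕ-fromℕ< i<N)) qi) (subst Q (sym (toℕ-fromℕ< j<N)) qj)
         (fi≢fj ∘ subst₂ (λ a b → f a ≡ f b) (toℕ-fromℕ< i<N) (toℕ-fromℕ< j<N))
  where
  adj : ∀ {x ℓ} → toℕ x ≡ ℓ → E (toℕ v) ℓ ⊎ E ℓ (toℕ v) → Adj (fromRel _ E) v x
  adj refl e = inj₁ e

restrict-determines : ∀ {G : Graph N} {P : Fin N → Set} (P? : Decidable P) {c} →
                      IsProperColoring G 3 c → (∀ v → ¬ P v → Forced G P c v) →
                      Determines G 3 (restrict P? c) c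
restrict-determines {P = P} P? {c} c-proper forcing c' c'-proper extends v = decide (P? v)
  where
  agree : ∀ {u} → P u → c' u ≡ c u
  agree u∈ = extends _ (c _) (restrict-∈ P? c u∈)
  decide : Dec (P v) → c' v ≡ c v
  decide (yes v∈) = agree v∈
  decide (no v∉)  = forced-agree c-proper c'-proper agree (forcing v v∉)

-- Uncoloured vertices of a Sudoku colouring

updateAt-view : ∀ {A : Set} (f : Fin N → A) v a z →
                (z ≡ v × updateAt f v (const a) z ≡ a) ⊎ (z ≢ v × updateAt f v (const a) z ≡ f z)
updateAt-view f v a z with z ≟ᶠ v
... | yes refl = inj₁ (refl , updateAt-updates v f)
... | no z≢v   = inj₂ (z≢v , updateAt-minimal z v f z≢v)

-- Each lemma exhibits a second proper extension of p, contradicting uniqueness.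
module Recolouring {G : Graph N} {p : PartialColoring N k} (sudoku : IsSudokuColoring G k p) where

  c : Fin N → Fin k
  c = proj₁ sudoku

  c-proper : IsProperColoring G k c
  c-proper = proj₁ (proj₁ (proj₂ sudoku))

  private
    c-extends : Extends c p
    c-extends = proj₂ (proj₁ (proj₂ sudoku))
    c-unique : Determines G k p c
    c-unique = proj₂ (proj₂ sudoku)

    no-loop : ∀ {s t} → G s t → s ≡ t → ⊥
    no-loop e refl = c-proper _ _ e refl

    via : ∀ (c' : Fin N → Fin k) {s t x y} → c' s ≡ x → c' t ≡ y → x ≢ y → c' s ≢ c' t
    via _ es et x≢y eq = x≢y (trans (sym es) (trans eq et))

    agree-on-coloured : ∀ {c'} → IsProperColoring G k c' →
                        (∀ z → p z ≢ nothing → c' z ≡ c z) → ∀ v → c' v ≡ c v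
    agree-on-coloured {c'} c'-proper agree = c-unique c' c'-proper λ z a pz →
      trans (agree z (λ pz≡nothing → contradiction (trans (sym pz) pz≡nothing) λ ()))
            (c-extends z a pz)

  free-sees-colour : ∀ {v a} → p v ≡ nothing → a ≢ c v → ¬ (∀ {z} → Adj G v z → c z ≢ a)
  free-sees-colour {v} {a} v-free a≢cv avoids =
    a≢cv (trans (sym (updateAt-updates v c)) (agree-on-coloured recoloured-proper unchanged v))
    where
    c' : Fin N → Fin k
    c' = updateAt c v (const a)
    recoloured-proper : IsProperColoring G k c'
    recoloured-proper s t e with updateAt-view c v a s | updateAt-view c v a t
    ... | inj₁ (refl , _)  | inj₁ (refl , _)  = ⊥-elim (no-loop e refl)
    ... | inj₁ (refl , es) | inj₂ (_ , et)    = via c' es et (avoids (inj₁ e) ∘ sym)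
    ... | inj₂ (_ , es)    | inj₁ (refl , et) = via c' es et (avoids (inj₂ e))
    ... | inj₂ (_ , es)    | inj₂ (_ , et)    = via c' es et (c-proper s t e)
    unchanged : ∀ z → p z ≢ nothing → c' z ≡ c z
    unchanged z coloured with updateAt-view c v a z
    ... | inj₁ (refl , _) = contradiction v-free coloured
    ... | inj₂ (_ , c'z)  = c'z

  free-edge-unswappable : ∀ {u w} → G u w → p u ≡ nothing → p w ≡ nothing →
                          (∀ {z} → z ≢ w → Adj G u z → c z ≢ c w) →
                          (∀ {z} → z ≢ u → Adj G w z → c z ≢ c u) → ⊥
  free-edge-unswappable {u} {w} uw u-free w-free u-avoids w-avoids =
    c-proper u w uw (sym (trans (sym swapped-u) (agree-on-coloured swapped-proper unchanged u)))
    where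
    c' : Fin N → Fin k
    c' = updateAt (updateAt c u (const (c w))) w (const (c u))
    u≢w : u ≢ w
    u≢w = no-loop uw
    swapped-u : c' u ≡ c w
    swapped-u = trans (updateAt-minimal u w _ u≢w) (updateAt-updates u c)
    view : ∀ z → (z ≡ u × c' z ≡ c w) ⊎ (z ≡ w × c' z ≡ c u) ⊎ (z ≢ u × z ≢ w × c' z ≡ c z)
    view z with updateAt-view (updateAt c u (const (c w))) w (c u) z
    ... | inj₁ (z≡w , eq) = inj₂ (inj₁ (z≡w , eq))
    ... | inj₂ (z≢w , eq) with updateAt-view c u (c w) z
    ...   | inj₁ (z≡u , eq′) = inj₁ (z≡u , trans eq eq′)
    ...   | inj₂ (z≢u , eq′) = inj₂ (inj₂ (z≢u , z≢w , trans eq eq′))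
    swapped-proper : IsProperColoring G k c'
    swapped-proper s t e with view s | view t
    ... | inj₁ (refl , _)            | inj₁ (refl , _)            = ⊥-elim (no-loop e refl)
    ... | inj₂ (inj₁ (refl , _))     | inj₂ (inj₁ (refl , _))     = ⊥-elim (no-loop e refl)
    ... | inj₁ (refl , es)           | inj₂ (inj₁ (refl , et))    = via c' es et (c-proper s t e ∘ sym)
    ... | inj₂ (inj₁ (refl , es))    | inj₁ (refl , et)           = via c' es et (c-proper s t e ∘ sym)
    ... | inj₁ (refl , es)           | inj₂ (inj₂ (_ , t≢w , et)) = via c' es et (u-avoids t≢w (inj₁ e) ∘ sym)
    ... | inj₂ (inj₂ (_ , s≢w , es)) | inj₁ (refl , et)           = via c' es et (u-avoids s≢w (inj₂ e))
    ... | inj₂ (inj₁ (refl , es))    | inj₂ (inj₂ (t≢u , _ , et)) = via c' es et (w-avoids t≢u (inj₁ e) ∘ sym)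
    ... | inj₂ (inj₂ (s≢u , _ , es)) | inj₂ (inj₁ (refl , et))    = via c' es et (w-avoids s≢u (inj₂ e))
    ... | inj₂ (inj₂ (_ , _ , es))   | inj₂ (inj₂ (_ , _ , et))   = via c' es et (c-proper s t e)
    unchanged : ∀ z → p z ≢ nothing → c' z ≡ c z
    unchanged z coloured with view z
    ... | inj₁ (refl , _)           = contradiction u-free coloured
    ... | inj₂ (inj₁ (refl , _))    = contradiction w-free coloured
    ... | inj₂ (inj₂ (_ , _ , c'z)) = c'z

module _ {G : Graph N} {p : PartialColoring N 3} (sudoku : IsSudokuColoring G 3 p) where
  open Recolouring sudoku

  atMostOneNeighbour⇒coloured : ∀ {v} → AtMostOneNeighbour G v → p v ≢ nothing
  atMostOneNeighbour⇒coloured {v} atMostOne v-free =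
    free-sees-colour v-free (other≢ˡ (c v) (c v)) λ vz cz≡a →
      free-sees-colour v-free (other≢ˡ (c v) a) λ vz′ cz′≡b →
        other≢ʳ (c v) a (trans (sym cz′≡b) (trans (cong c (atMostOne vz′ vz)) cz≡a))
    where
    a : Fin 3
    a = other (c v) (c v)

  private
    others-avoid : ∀ {u w} → AtMostTwoNeighbours G u → Adj G u w → p u ≡ nothing →
                   ∀ {z} → z ≢ w → Adj G u z → c z ≢ c w
    others-avoid {u} {w} atMostTwo uw u-free {z} z≢w uz cz≡cw =
      free-sees-colour u-free (other≢ˡ (c u) (c w)) λ uz′ cz′≡a →
        other≢ʳ (c u) (c w) (trans (sym cz′≡a) (colour-c-w (atMostTwo uz′ uz uw)))
      where
      colour-c-w : ∀ {z′} → z′ ≡ z ⊎ z′ ≡ w ⊎ z ≡ w → c z′ ≡ c w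
      colour-c-w (inj₁ refl)        = cz≡cw
      colour-c-w (inj₂ (inj₁ refl)) = refl
      colour-c-w (inj₂ (inj₂ z≡w))  = contradiction z≡w z≢w

  ¬free-edge-of-atMostTwoNeighbours : ∀ {u w} → G u w → AtMostTwoNeighbours G u →
                                      AtMostTwoNeighbours G w → p u ≡ nothing → p w ≡ nothing → ⊥
  ¬free-edge-of-atMostTwoNeighbours uw u-two w-two u-free w-free =
    free-edge-unswappable uw u-free w-free
      (others-avoid u-two (inj₁ uw) u-free) (others-avoid w-two (inj₂ uw) w-free)

  ¬free-pair-of-joined-neighbourhoods : ∀ {u w} → p u ≡ nothing → p w ≡ nothing →
                                        (∀ {x y} → Adj G u x → Adj G w y → Adj G x y) → ⊥
  ¬free-pair-of-joined-neighbourhoods {u} {w} u-free w-free joined =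
    free-sees-colour w-free (other≢ʳ (c u) (c w)) λ wy cy≡a →
      free-sees-colour u-free (other≢ˡ (c u) (c w)) λ ux cx≡a →
        proper-adj c-proper (joined ux wy) (trans cx≡a (sym cy≡a))

  noConsecutiveFree : (∀ {i j} → toℕ j ≡ suc (toℕ i) → G i j) →
                      (∀ u → AtMostTwoNeighbours G u) → NoConsecutiveFree p
  noConsecutiveFree edge two j≡1+i =
    ¬free-edge-of-atMostTwoNeighbours (edge j≡1+i) (two _) (two _)

-- Paths and cycles

alternate : ℕ → Fin 3
alternate zero          = c0
alternate (suc zero)    = c1
alternate (suc (suc k)) = alternate k

alternate-step : ∀ k → alternate k ≢ alternate (suc k)
alternate-step zero          ()
alternate-step (suc zero)    ()
alternate-step (suc (suc k)) = alternate-step k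

alternate≢c2 : ∀ k → alternate k ≢ c2
alternate≢c2 zero          ()
alternate≢c2 (suc zero)    ()
alternate≢c2 (suc (suc k)) = alternate≢c2 k

interleave : (ℕ → Fin 3) → ℕ → Fin 3
interleave a zero          = a 0
interleave a (suc zero)    = other (a 0) (a 1)
interleave a (suc (suc i)) = interleave (a ∘ suc) i

interleave-even : ∀ a k → interleave a (k + k) ≡ a k
interleave-even a zero    = refl
interleave-even a (suc k) rewrite +-suc k k = interleave-even (a ∘ suc) k

interleave-odd : ∀ a k → interleave a (suc (k + k)) ≡ other (a k) (a (suc k))
interleave-odd a zero    = refl
interleave-odd a (suc k) rewrite +-suc k k = interleave-odd (a ∘ suc) k

interleave-step : ∀ a i → interleave a i ≢ interleave a (suc i)
interleave-step a zero          = other≢ˡ (a 0) (a 1) ∘ sym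
interleave-step a (suc zero)    = other≢ʳ (a 0) (a 1)
interleave-step a (suc (suc i)) = interleave-step (a ∘ suc) i

even : ℕ → Bool
even zero          = true
even (suc zero)    = false
even (suc (suc i)) = even i

even-double : ∀ k → T (even (k + k))
even-double zero    = _
even-double (suc k) rewrite +-suc k k = even-double k

odd⇒double+1 : ∀ i → ¬ T (even i) → ∃ λ k → i ≡ suc (k + k)
odd⇒double+1 zero          not-even = contradiction _ not-even
odd⇒double+1 (suc zero)    _        = 0 , refl
odd⇒double+1 (suc (suc i)) not-even with odd⇒double+1 i not-even
... | k , refl = suc k , cong (suc ∘ suc) (sym (+-suc k k))

Even? : Decidable {A = Fin N} (T ∘ even ∘ toℕ)
Even? v = T? (even (toℕ v))

domSize-restrict-Even : ∀ N (c : Fin N → Fin k) → domSize (restrict Even? c) ≡ ⌈ N /2⌉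
domSize-restrict-Even zero          c = refl
domSize-restrict-Even (suc zero)    c = refl
domSize-restrict-Even (suc (suc N)) c = cong suc (domSize-restrict-Even N (tail (tail c)))

PathLabel : ℕ → ℕ → Set
PathLabel N ℓ = T (even ℓ) ⊎ suc ℓ ≡ N

PathSet? : ∀ N → Decidable {A = Fin N} (PathLabel N ∘ toℕ)
PathSet? N v = T? (even (toℕ v)) ⊎-dec (suc (toℕ v) ≟ N)

domSize-restrict-PathSet : ∀ n (c : Fin (suc n) → Fin k) →
                           domSize (restrict (PathSet? (suc n)) c) ≡ ⌈ suc (suc n) /2⌉
domSize-restrict-PathSet zero          c = refl
domSize-restrict-PathSet (suc zero)    c = refl
domSize-restrict-PathSet (suc (suc n)) c = cong suc (domSize-restrict-PathSet n (tail (tail c)))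

pathColour : Fin N → Fin 3
pathColour = interleave alternate ∘ toℕ

path-proper : IsProperColoring (Path N) 3 pathColour
path-proper = fromRel-proper {E = pathE} {f = interleave alternate} step
  where
  step : ∀ {i j} → pathE i j → interleave alternate i ≢ interleave alternate j
  step {i} refl = interleave-step alternate i

path-forced : ∀ v → ¬ PathLabel N (toℕ v) → Forced (Path N) (PathLabel N ∘ toℕ) pathColour v
path-forced {N} v v∉ with odd⇒double+1 (toℕ v) (v∉ ∘ inj₁)
... | k , v≡2k+1 =
  forcedByLabels {E = pathE} {Q = PathLabel N} {f = interleave alternate} left<N right<N
    (inj₂ v≡2k+1) (inj₁ right≡v+1) (inj₁ (even-double k)) (inj₁ (even-double (suc k))) distinct
  where
  left<N : k + k < N
  left<N = <-trans (n<1+n _) (subst (_< N) v≡2k+1 (toℕ<n v))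
  right≡v+1 : suc k + suc k ≡ suc (toℕ v)
  right≡v+1 = cong suc (trans (+-suc k k) (sym v≡2k+1))
  right<N : suc k + suc k < N
  right<N = subst (_< N) (sym right≡v+1) (≤∧≢⇒< (toℕ<n v) (v∉ ∘ inj₂))
  distinct : interleave alternate (k + k) ≢ interleave alternate (suc k + suc k)
  distinct rewrite interleave-even alternate k | interleave-even alternate (suc k) =
    alternate-step k

path-atMostTwoNeighbours : ∀ u → AtMostTwoNeighbours (Path N) u
path-atMostTwoNeighbours {N} u =
  atMostTwoNeighbours {G = Path N} (λ z → toℕ z ≡ suc (toℕ u)) (λ z → toℕ u ≡ suc (toℕ z))
    (adj-fromRel {E = pathE})
    (λ x≡ y≡ → toℕ-injective (trans x≡ (sym y≡)))
    (λ x≡ y≡ → toℕ-injective (suc-injective (trans (sym x≡) y≡)))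

path-lowerBound : ∀ n q → IsSudokuColoring (Path (suc n)) 3 q → ⌈ suc (suc n) /2⌉ ≤ domSize q
path-lowerBound n q sudoku = begin
  suc ⌈ n /2⌉             ≤⟨ s≤s (⌈/2⌉≤domSize n (tail q) (tail-noConsecutiveFree no-free-pair)
                                                         (tail-lastColoured last-coloured)) ⟩
  suc (domSize (tail q))  ≡⟨ domSize-coloured-head q first-coloured ⟨
  domSize q               ∎
  where
  open ≤-Reasoning
  no-free-pair : NoConsecutiveFree q
  no-free-pair = noConsecutiveFree sudoku inj₁ path-atMostTwoNeighbours
  first-coloured : q fzero ≢ nothing
  first-coloured =
    atMostOneNeighbour⇒coloured sudoku (atMostOneNeighbour {G = Path (suc n)} 1 first-label)
    where
    first-label : ∀ {z} → Adj (Path (suc n)) fzero z → toℕ z ≡ 1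
    first-label a with adj-fromRel {E = pathE} a
    ... | inj₁ z≡1 = z≡1
    ... | inj₂ ()
  last-coloured : LastColoured q
  last-coloured u u-last =
    atMostOneNeighbour⇒coloured sudoku (atMostOneNeighbour {G = Path (suc n)} (toℕ u ∸ 1) last-label)
    where
    last-label : ∀ {z} → Adj (Path (suc n)) u z → toℕ z ≡ toℕ u ∸ 1
    last-label {z} a with adj-fromRel {E = pathE} a
    ... | inj₁ z≡u+1 = contradiction (toℕ<n z) (<-irrefl (trans z≡u+1 u-last))
    ... | inj₂ u≡z+1 = cong (_∸ 1) (sym u≡z+1)

path-sudokuNumber : ∀ n → 1 ≤ n → IsSudokuNumber (Path n) 3 ⌈ suc n /2⌉
path-sudokuNumber (suc n) _ =
  isSudokuNumber path-proper (restrict-extends (PathSet? _) pathColour)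
    (restrict-determines (PathSet? _) path-proper path-forced)
    (domSize-restrict-PathSet n pathColour) (path-lowerBound n)

-- The anchors of C_{2n}, i.e. the colours of its even vertices 2k, are cycleAnchor n k for k ≤ n,
-- where vertex 2n is vertex 0 again: they alternate c0, c1 except that the last two are c2, c0,
-- so that consecutive anchors differ and anchor n equals anchor 0.
anchorFromEnd : ℕ → ℕ → Fin 3
anchorFromEnd zero          _ = c0
anchorFromEnd (suc zero)    _ = c2
anchorFromEnd (suc (suc _)) k = alternate k

anchorFromEnd-step : ∀ d k → anchorFromEnd (suc d) k ≢ anchorFromEnd d (suc k)
anchorFromEnd-step zero          k ()
anchorFromEnd-step (suc zero)    k = alternate≢c2 k
anchorFromEnd-step (suc (suc d)) k = alternate-step k

cycleAnchor : ℕ → ℕ → Fin 3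
cycleAnchor n k = anchorFromEnd (n ∸ k) k

cycleAnchor-step : ∀ {n k} → k < n → cycleAnchor n k ≢ cycleAnchor n (suc k)
cycleAnchor-step {n} {k} k<n = subst (λ d → anchorFromEnd d k ≢ cycleAnchor n (suc k))
  (sym n∸k≡1+n∸[1+k]) (anchorFromEnd-step (n ∸ suc k) k)
  where
  n∸k≡1+n∸[1+k] : n ∸ k ≡ suc (n ∸ suc k)
  n∸k≡1+n∸[1+k] = +-∸-assoc 1 k<n

cycleAnchor-wrap : ∀ {n} → 2 ≤ n → cycleAnchor n n ≡ cycleAnchor n 0
cycleAnchor-wrap {n} (s≤s (s≤s _)) = cong (λ d → anchorFromEnd d n) (n∸n≡0 n)

cycleColour : ∀ n → Fin (n + n) → Fin 3
cycleColour n = interleave (cycleAnchor n) ∘ toℕ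

cycle-proper : ∀ {n} → 2 ≤ n → IsProperColoring (Cycle (n + n)) 3 (cycleColour n)
cycle-proper {n@(suc n′)} 2≤n = fromRel-proper {E = cycleE (n + n)} {f = interleave a} step
  where
  a : ℕ → Fin 3
  a = cycleAnchor n
  step : ∀ {i j} → cycleE (n + n) i j → interleave a i ≢ interleave a j
  step {i} (inj₁ refl)     = interleave-step a i
  step (inj₂ (refl , refl)) eq = other≢ʳ (a n′) (a n) (begin
    other (a n′) (a n)           ≡⟨ interleave-odd a n′ ⟨
    interleave a (suc (n′ + n′)) ≡⟨ cong (interleave a) (+-suc n′ n′) ⟨
    interleave a (n′ + n)        ≡⟨ eq ⟩
    a 0                          ≡⟨ cycleAnchor-wrap 2≤n ⟨
    a n                          ∎)
    where open ≡-Reasoning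

cycle-forced : ∀ {n} → 2 ≤ n → ∀ v → ¬ T (even (toℕ v)) →
               Forced (Cycle (n + n)) (T ∘ even ∘ toℕ) (cycleColour n) v
cycle-forced {n} 2≤n v not-even with odd⇒double+1 (toℕ v) not-even
... | k , v≡2k+1 = right-neighbour (suc k <? n)
  where
  a : ℕ → Fin 3
  a = cycleAnchor n
  k<n : k < n
  k<n = ≰⇒> λ n≤k → ≤⇒≯ (+-mono-≤ n≤k n≤k) (<-trans (n<1+n _) (subst (_< n + n) v≡2k+1 (toℕ<n v)))
  left<2n : k + k < n + n
  left<2n = +-mono-< k<n k<n
  forcedBy : ∀ {j} → j < n + n → cycleE (n + n) (toℕ v) j → interleave a (k + k) ≢ interleave a j →
             T (even j) → Forced (Cycle (n + n)) (T ∘ even ∘ toℕ) (cycleColour n) v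
  forcedBy j<2n vj distinct even-j =
    forcedByLabels {E = cycleE (n + n)} {Q = T ∘ even} {f = interleave a} left<2n j<2n
      (inj₂ (inj₁ v≡2k+1)) (inj₁ vj) (even-double k) even-j distinct
  right-neighbour : Dec (suc k < n) → Forced (Cycle (n + n)) (T ∘ even ∘ toℕ) (cycleColour n) v
  right-neighbour (yes 1+k<n) =
    forcedBy (+-mono-≤-< (<⇒≤ 1+k<n) 1+k<n) (inj₁ (cong suc (trans (+-suc k k) (sym v≡2k+1))))
             distinct (even-double (suc k))
    where
    distinct : interleave a (k + k) ≢ interleave a (suc k + suc k)
    distinct rewrite interleave-even a k | interleave-even a (suc k) = cycleAnchor-step k<n
  right-neighbour (no 1+k≮n) =
    forcedBy (≤-trans (s≤s z≤n) left<2n) (inj₂ (v≡2n-1 , refl)) distinct _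
    where
    1+k≡n : suc k ≡ n
    1+k≡n = ≤-antisym k<n (≮⇒≥ 1+k≮n)
    v≡2n-1 : toℕ v ≡ n + n ∸ 1
    v≡2n-1 = trans v≡2k+1 (trans (sym (+-suc k k)) (cong (λ x → x + x ∸ 1) 1+k≡n))
    distinct : interleave a (k + k) ≢ a 0
    distinct rewrite interleave-even a k = λ eq →
      cycleAnchor-step k<n (trans eq (trans (sym (cycleAnchor-wrap 2≤n)) (cong a (sym 1+k≡n))))

cycle-atMostTwoNeighbours : ∀ {m} u → AtMostTwoNeighbours (Cycle m) u
cycle-atMostTwoNeighbours {m} u =
  atMostTwoNeighbours {G = Cycle m}
    (λ z → cycleE m (toℕ u) (toℕ z)) (λ z → cycleE m (toℕ z) (toℕ u)) (adj-fromRel {E = cycleE m})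
    successor-unique predecessor-unique
  where
  past-end : ∀ {x} → toℕ x ≡ suc (toℕ u) → toℕ u ≡ m ∸ 1 → ⊥
  past-end {x} x≡u+1 u≡m-1 =
    ≤⇒≯ (subst (m ≤_) (sym (trans x≡u+1 (cong suc u≡m-1))) (m≤n+m∸n m 1)) (toℕ<n x)
  successor-unique : ∀ {x y} → cycleE m (toℕ u) (toℕ x) → cycleE m (toℕ u) (toℕ y) → x ≡ y
  successor-unique (inj₁ x≡u+1)       (inj₁ y≡u+1)       = toℕ-injective (trans x≡u+1 (sym y≡u+1))
  successor-unique (inj₂ (_ , x≡0))   (inj₂ (_ , y≡0))   = toℕ-injective (trans x≡0 (sym y≡0))
  successor-unique (inj₁ x≡u+1)       (inj₂ (u≡m-1 , _)) = ⊥-elim (past-end x≡u+1 u≡m-1)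
  successor-unique (inj₂ (u≡m-1 , _)) (inj₁ y≡u+1)       = ⊥-elim (past-end y≡u+1 u≡m-1)
  predecessor-unique : ∀ {x y} → cycleE m (toℕ x) (toℕ u) → cycleE m (toℕ y) (toℕ u) → x ≡ y
  predecessor-unique (inj₁ u≡x+1)       (inj₁ u≡y+1)       =
    toℕ-injective (suc-injective (trans (sym u≡x+1) u≡y+1))
  predecessor-unique (inj₂ (x≡m-1 , _)) (inj₂ (y≡m-1 , _)) = toℕ-injective (trans x≡m-1 (sym y≡m-1))
  predecessor-unique (inj₁ u≡x+1)       (inj₂ (_ , u≡0))   = case (trans (sym u≡x+1) u≡0) of λ ()
  predecessor-unique (inj₂ (_ , u≡0))   (inj₁ u≡y+1)       = case (trans (sym u≡y+1) u≡0) of λ ()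

cycle-lowerBound : ∀ n q → IsSudokuColoring (Cycle (n + n)) 3 q → n ≤ domSize q
cycle-lowerBound n q sudoku = subst (_≤ domSize q) (sym (n≡⌊n+n/2⌋ n))
  (⌊/2⌋≤domSize (n + n) q (noConsecutiveFree sudoku (inj₁ ∘ inj₁) cycle-atMostTwoNeighbours))

cycle-sudokuNumber : ∀ n → 2 ≤ n → IsSudokuNumber (Cycle (n + n)) 3 n
cycle-sudokuNumber n 2≤n =
  isSudokuNumber (cycle-proper 2≤n) (restrict-extends Even? (cycleColour n))
    (restrict-determines Even? (cycle-proper 2≤n) (cycle-forced 2≤n))
    (trans (domSize-restrict-Even (n + n) (cycleColour n)) (sym (n≡⌈n+n/2⌉ n)))
    (cycle-lowerBound n)

-- Stars

starColour : ℕ → Fin 3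
starColour zero    = c2
starColour (suc j) = c0-then c1 j

star-proper : ∀ {n} → IsProperColoring (Star n) 3 (starColour ∘ toℕ)
star-proper = fromRel-proper {E = starE} {f = starColour} step
  where
  step : ∀ {i j} → starE i j → starColour i ≢ starColour j
  step {j = suc j} (refl , _) = c0-then-≢ j (λ ()) (λ ()) ∘ sym

star-forced : ∀ {n} → 2 ≤ n → ∀ v → ¬ toℕ v ≮ 1 →
              Forced (Star n) (λ v → toℕ v ≮ 1) (starColour ∘ toℕ) v
star-forced (s≤s (s≤s _)) fzero    _     =
  forcedByLabels {E = starE} {Q = _≮ 1} {f = starColour} (s≤s (s≤s z≤n)) (s≤s (s≤s (s≤s z≤n)))
    (inj₁ (refl , s≤s z≤n)) (inj₁ (refl , s≤s z≤n)) (<-irrefl refl) (≤⇒≯ (s≤s z≤n)) λ ()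
star-forced _             (fsuc _) leaf∉ = contradiction (≤⇒≯ (s≤s z≤n)) leaf∉

star-lowerBound : ∀ n q → IsSudokuColoring (Star n) 3 q → n ≤ domSize q
star-lowerBound n q sudoku = subst (_≤ domSize q) (domSize-restrict-NotBelow 1 (starColour ∘ toℕ))
  (restrict-≤-domSize (NotBelow? 1) (starColour ∘ toℕ) q leaf-coloured)
  where
  leaf-coloured : ∀ v → toℕ v ≮ 1 → q v ≢ nothing
  leaf-coloured fzero    not-centre = contradiction (s≤s z≤n) not-centre
  leaf-coloured (fsuc i) _          = atMostOneNeighbour⇒coloured sudoku
    (atMostOneNeighbour {G = Star n} 0 centre-label)
    where
    centre-label : ∀ {z} → Adj (Star n) (fsuc i) z → toℕ z ≡ 0
    centre-label a with adj-fromRel {E = starE} a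
    ... | inj₂ (z≡0 , _) = z≡0

star-sudokuNumber : ∀ n → 2 ≤ n → IsSudokuNumber (Star n) 3 n
star-sudokuNumber n 2≤n =
  isSudokuNumber star-proper (restrict-extends (NotBelow? 1) (starColour ∘ toℕ))
    (restrict-determines (NotBelow? 1) star-proper (star-forced 2≤n))
    (domSize-restrict-NotBelow 1 (starColour ∘ toℕ)) (star-lowerBound n)

-- Complete bipartite graphs

bipartiteColour : ℕ → ℕ → Fin 3
bipartiteColour m i with i <? m
... | yes _ = c0-then c1 i
... | no _  = c2

module _ {m n : ℕ} where

  private
    G : Graph (m + n)
    G = CompleteBipartite m n
    colour : Fin (m + n) → Fin 3
    colour = bipartiteColour m ∘ toℕ

  bipartite-proper : IsProperColoring G 3 colour
  bipartite-proper = fromRel-proper {E = bipE m} {f = bipartiteColour m} step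
    where
    step : ∀ {i j} → bipE m i j → bipartiteColour m i ≢ bipartiteColour m j
    step {i} {j} (i<m , m≤j) with i <? m | j <? m
    ... | yes _    | no _    = c0-then-≢ i (λ ()) (λ ())
    ... | no i≮m   | _       = contradiction i<m i≮m
    ... | _        | yes j<m = contradiction j<m (≤⇒≯ m≤j)

  bipartite-forced : 2 ≤ m → ∀ v → ¬ toℕ v < m → Forced G (λ v → toℕ v < m) colour v
  bipartite-forced (s≤s (s≤s _)) v v∉ =
    forcedByLabels {E = bipE m} {Q = _< m} {f = bipartiteColour m} (s≤s z≤n) (s≤s (s≤s z≤n))
      (inj₂ (s≤s z≤n , ≮⇒≥ v∉)) (inj₂ (s≤s (s≤s z≤n) , ≮⇒≥ v∉)) (s≤s z≤n) (s≤s (s≤s z≤n)) λ ()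

  private
    left-across : ∀ {u x} → toℕ u < m → Adj G u x → m ≤ toℕ x
    left-across u<m ux with adj-fromRel {E = bipE m} ux
    ... | inj₁ (_ , m≤x) = m≤x
    ... | inj₂ (_ , m≤u) = contradiction u<m (≤⇒≯ m≤u)

    right-across : ∀ {w y} → toℕ w ≮ m → Adj G w y → toℕ y < m
    right-across w≮m wy with adj-fromRel {E = bipE m} wy
    ... | inj₁ (w<m , _) = contradiction w<m w≮m
    ... | inj₂ (y<m , _) = y<m

  bipartite-lowerBound : m ≤ n → ∀ q → IsSudokuColoring G 3 q → m ≤ domSize q
  bipartite-lowerBound m≤n q sudoku with any? (λ u → Below? m u ×-dec free? (q u))
  ... | yes (u , u<m , u-free) = ≤-trans m≤n
          (subst (_≤ domSize q) (domSize-restrict-NotBelow m {n} colour)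
                 (restrict-≤-domSize (NotBelow? m) colour q right-coloured))
    where
    right-coloured : ∀ w → toℕ w ≮ m → q w ≢ nothing
    right-coloured w w≮m w-free = ¬free-pair-of-joined-neighbourhoods sudoku u-free w-free
      λ ux wy → inj₂ (inj₁ (right-across w≮m wy , left-across u<m ux))
  ... | no no-free-left = subst (_≤ domSize q) (domSize-restrict-Below m {n} colour)
          (restrict-≤-domSize (Below? m) colour q λ v v<m v-free → no-free-left (v , v<m , v-free))

completeBipartite-sudokuNumber : ∀ m n → 2 ≤ m → m ≤ n → IsSudokuNumber (CompleteBipartite m n) 3 m
completeBipartite-sudokuNumber m n 2≤m m≤n =
  isSudokuNumber bipartite-proper (restrict-extends (Below? m) (bipartiteColour m ∘ toℕ))
    (restrict-determines (Below? m) bipartite-proper (bipartite-forced 2≤m))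
    (domSize-restrict-Below m {n} (bipartiteColour m ∘ toℕ)) (bipartite-lowerBound m≤n)

-- Bistars

leafColour : ℕ → ℕ → Fin 3
leafColour m j with j <? m
... | yes _ = c0-then c1 j
... | no _  = c0-then c2 (j ∸ m)

leafColour-below : ∀ {m j} → j < m → leafColour m j ≡ c0-then c1 j
leafColour-below {m} {j} j<m with j <? m
... | yes _  = refl
... | no j≮m = contradiction j<m j≮m

leafColour-notBelow : ∀ {m j} → j ≮ m → leafColour m j ≡ c0-then c2 (j ∸ m)
leafColour-notBelow {m} {j} j≮m with j <? m
... | yes j<m = contradiction j<m j≮m
... | no _    = refl

bistarColour : ℕ → ℕ → Fin 3
bistarColour m zero          = c2
bistarColour m (suc zero)    = c1
bistarColour m (suc (suc j)) = leafColour m j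

module _ {m n : ℕ} where

  private
    G : Graph (2 + m + n)
    G = Bistar m n
    colour : Fin (2 + m + n) → Fin 3
    colour = bistarColour m ∘ toℕ

  bistar-proper : IsProperColoring G 3 colour
  bistar-proper = fromRel-proper {E = bistarE m} {f = bistarColour m} step
    where
    step : ∀ {i j} → bistarE m i j → bistarColour m i ≢ bistarColour m j
    step (inj₁ (refl , refl)) ()
    step {j = suc (suc j)} (inj₂ (inj₁ (refl , s≤s (s≤s z≤n) , s≤s (s≤s j<m))))
      rewrite leafColour-below j<m = c0-then-≢ j (λ ()) (λ ()) ∘ sym
    step {j = suc (suc j)} (inj₂ (inj₂ (refl , s≤s (s≤s m≤j))))
      rewrite leafColour-notBelow (≤⇒≯ m≤j) = c0-then-≢ (j ∸ m) (λ ()) (λ ()) ∘ sym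

  private
    leaf-neighbour : ∀ {i z} → Adj G (fsuc (fsuc i)) z →
                     (toℕ z ≡ 0 × toℕ i < m) ⊎ (toℕ z ≡ 1 × m ≤ toℕ i)
    leaf-neighbour a with adj-fromRel {E = bistarE m} a
    ... | inj₁ (inj₁ (() , _))
    ... | inj₁ (inj₂ (inj₁ (() , _)))
    ... | inj₁ (inj₂ (inj₂ (() , _)))
    ... | inj₂ (inj₁ (_ , ()))
    ... | inj₂ (inj₂ (inj₁ (z≡0 , _ , s≤s (s≤s i<m)))) = inj₁ (z≡0 , i<m)
    ... | inj₂ (inj₂ (inj₂ (z≡1 , s≤s (s≤s m≤i))))    = inj₂ (z≡1 , m≤i)

    leaf-atMostOneNeighbour : ∀ i → AtMostOneNeighbour G (fsuc (fsuc i))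
    leaf-atMostOneNeighbour i vx vy with leaf-neighbour vx | leaf-neighbour vy
    ... | inj₁ (x≡0 , _)   | inj₁ (y≡0 , _)   = toℕ-injective (trans x≡0 (sym y≡0))
    ... | inj₂ (x≡1 , _)   | inj₂ (y≡1 , _)   = toℕ-injective (trans x≡1 (sym y≡1))
    ... | inj₁ (_ , i<m)   | inj₂ (_ , m≤i)   = contradiction i<m (≤⇒≯ m≤i)
    ... | inj₂ (_ , m≤i)   | inj₁ (_ , i<m)   = contradiction i<m (≤⇒≯ m≤i)

  bistar-leaf-coloured : ∀ {q} → IsSudokuColoring G 3 q → ∀ i → q (fsuc (fsuc i)) ≢ nothing
  bistar-leaf-coloured sudoku i = atMostOneNeighbour⇒coloured sudoku (leaf-atMostOneNeighbour i)

  bistar-lowerBound : ∀ q → IsSudokuColoring G 3 q → m + n ≤ domSize q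
  bistar-lowerBound q sudoku = subst (_≤ domSize q) (domSize-restrict-NotBelow 2 {m + n} colour)
    (restrict-≤-domSize (NotBelow? 2) colour q leaves-coloured)
    where
    leaves-coloured : ∀ v → toℕ v ≮ 2 → q v ≢ nothing
    leaves-coloured fzero           leaf = contradiction (s≤s z≤n) leaf
    leaves-coloured (fsuc fzero)    leaf = contradiction (s≤s (s≤s z≤n)) leaf
    leaves-coloured (fsuc (fsuc i)) _    = bistar-leaf-coloured sudoku i

  private
    leaf-label : ∀ {j} → 2 + j ≮ 2
    leaf-label = ≤⇒≯ (s≤s (s≤s z≤n))

    leaf<N : ∀ {j} → j < m + n → 2 + j < 2 + m + n
    leaf<N j<m+n = s≤s (s≤s j<m+n)

    centre₀-leaf : ∀ {j} → j < m → bistarE m 0 (2 + j)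
    centre₀-leaf j<m = inj₂ (inj₁ (refl , s≤s (s≤s z≤n) , s≤s (s≤s j<m)))

    centre₁-leaf : ∀ {j} → m ≤ j → bistarE m 1 (2 + j)
    centre₁-leaf m≤j = inj₂ (inj₂ (refl , s≤s (s≤s m≤j)))

    leafColour-m : leafColour m m ≡ c0
    leafColour-m = trans (leafColour-notBelow {m} (<-irrefl refl)) (cong (c0-then c2) (n∸n≡0 m))

    leafColour-1+m : leafColour m (suc m) ≡ c2
    leafColour-1+m =
      trans (leafColour-notBelow {m} (≤⇒≯ (n≤1+n m))) (cong (c0-then c2) (m+n∸n≡m 1 m))

    module Extension (1≤m : 1 ≤ m) (1≤n : 1 ≤ n) {c' : Fin (2 + m + n) → Fin 3}
                     (c'-proper : IsProperColoring G 3 c')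
                     (extends : Extends c' (restrict (NotBelow? 2) colour)) where

      leaf-agree : ∀ {u} → toℕ u ≮ 2 → c' u ≡ colour u
      leaf-agree leaf = extends _ _ (restrict-∈ (NotBelow? 2) colour leaf)

      then-agree : ∀ {x} → c' x ≡ colour x →
                   ∀ {w} → Forced G (λ u → toℕ u ≮ 2 ⊎ toℕ u ≡ toℕ x) colour w → c' w ≡ colour w
      then-agree {x} x-agree = forced-agree bistar-proper c'-proper known
        where
        known : ∀ {u} → toℕ u ≮ 2 ⊎ toℕ u ≡ toℕ x → c' u ≡ colour u
        known (inj₁ leaf) = leaf-agree leaf
        known (inj₂ u≡x) rewrite toℕ-injective u≡x = x-agree

      first-leaf<N : 2 < 2 + m + n
      first-leaf<N = leaf<N (≤-trans 1≤m (m≤m+n m n))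

      first-leaf-of-centre₁<N : 2 + m < 2 + m + n
      first-leaf-of-centre₁<N = leaf<N (m<m+n m 1≤n)

      Centres-agree : Set
      Centres-agree = c' fzero ≡ colour fzero × c' (fsuc fzero) ≡ colour (fsuc fzero)

      centres-agree-if-2≤m : 2 ≤ m → Centres-agree
      centres-agree-if-2≤m 2≤m = centre₀ , then-agree centre₀
        (forcedByLabels {E = bistarE m} {Q = λ ℓ → ℓ ≮ 2 ⊎ ℓ ≡ 0} {f = bistarColour m}
          (s≤s z≤n) first-leaf-of-centre₁<N (inj₂ (inj₁ (refl , refl))) (inj₁ (centre₁-leaf ≤-refl))
          (inj₂ refl) (inj₁ leaf-label) (subst (c2 ≢_) (sym leafColour-m) λ ()))
        where
        centre₀ : c' fzero ≡ colour fzero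
        centre₀ = forced-agree bistar-proper c'-proper leaf-agree
          (forcedByLabels {E = bistarE m} {Q = _≮ 2} {f = bistarColour m}
            first-leaf<N (leaf<N (≤-trans 2≤m (m≤m+n m n)))
            (inj₁ (centre₀-leaf 1≤m)) (inj₁ (centre₀-leaf 2≤m)) leaf-label leaf-label
            (subst₂ _≢_ (sym (leafColour-below 1≤m)) (sym (leafColour-below 2≤m)) λ ()))

      centres-agree-if-2≤n : 2 ≤ n → Centres-agree
      centres-agree-if-2≤n 2≤n = then-agree centre₁
        (forcedByLabels {E = bistarE m} {Q = λ ℓ → ℓ ≮ 2 ⊎ ℓ ≡ 1} {f = bistarColour m}
          (s≤s (s≤s z≤n)) first-leaf<N (inj₁ (inj₁ (refl , refl))) (inj₁ (centre₀-leaf 1≤m))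
          (inj₂ refl) (inj₁ leaf-label) (subst (c1 ≢_) (sym (leafColour-below 1≤m)) λ ()))
        , centre₁
        where
        second-leaf-of-centre₁<N : 3 + m < 2 + m + n
        second-leaf-of-centre₁<N = leaf<N (subst (_≤ m + n) (+-comm m 2) (+-monoʳ-≤ m 2≤n))
        centre₁ : c' (fsuc fzero) ≡ colour (fsuc fzero)
        centre₁ = forced-agree bistar-proper c'-proper leaf-agree
          (forcedByLabels {E = bistarE m} {Q = _≮ 2} {f = bistarColour m}
            first-leaf-of-centre₁<N second-leaf-of-centre₁<N
            (inj₁ (centre₁-leaf ≤-refl)) (inj₁ (centre₁-leaf (n≤1+n m))) leaf-label leaf-label
            (subst₂ _≢_ (sym leafColour-m) (sym leafColour-1+m) λ ()))

  bistar-determines : 1 ≤ m → 1 ≤ n → ¬ (m ≡ 1 × n ≡ 1) →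
                      Determines G 3 (restrict (NotBelow? 2) colour) colour
  bistar-determines 1≤m 1≤n not-B₁₁ c' c'-proper extends = agree
    where
    open Extension 1≤m 1≤n c'-proper extends

    centres-agree : Centres-agree
    centres-agree with m ≟ 1
    ... | no m≢1  = centres-agree-if-2≤m (≤∧≢⇒< 1≤m (m≢1 ∘ sym))
    ... | yes m≡1 = centres-agree-if-2≤n (≤∧≢⇒< 1≤n (λ 1≡n → not-B₁₁ (m≡1 , sym 1≡n)))

    agree : ∀ v → c' v ≡ colour v
    agree fzero           = proj₁ centres-agree
    agree (fsuc fzero)    = proj₂ centres-agree
    agree (fsuc (fsuc _)) = leaf-agree leaf-label

bistar-sudokuNumber : ∀ m n → 1 ≤ m → 1 ≤ n → ¬ (m ≡ 1 × n ≡ 1) →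
                      IsSudokuNumber (Bistar m n) 3 (m + n)
bistar-sudokuNumber m n 1≤m 1≤n not-B₁₁ =
  isSudokuNumber bistar-proper (restrict-extends (NotBelow? 2) (bistarColour m ∘ toℕ))
    (bistar-determines 1≤m 1≤n not-B₁₁)
    (domSize-restrict-NotBelow 2 {m + n} (bistarColour m ∘ toℕ)) bistar-lowerBound

ExceptLabel? : ∀ ℓ → Decidable {A = Fin N} (λ v → toℕ v ≢ ℓ)
ExceptLabel? ℓ v = ¬? (toℕ v ≟ ℓ)

bistar₁₁-forced : ∀ v → ¬ toℕ v ≢ 1 → Forced (Bistar 1 1) (λ v → toℕ v ≢ 1) (bistarColour 1 ∘ toℕ) v
bistar₁₁-forced fzero           v∉ = contradiction (λ ()) v∉
bistar₁₁-forced (fsuc fzero)    _  =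
  forcedByLabels {E = bistarE 1} {Q = _≢ 1} {f = bistarColour 1} (s≤s z≤n) ≤-refl
    (inj₂ (inj₁ (refl , refl))) (inj₁ (inj₂ (inj₂ (refl , ≤-refl)))) (λ ()) (λ ()) (λ ())
bistar₁₁-forced (fsuc (fsuc _)) v∉ = contradiction (λ ()) v∉

bistar₁₁-lowerBound : ∀ q → IsSudokuColoring (Bistar 1 1) 3 q → 3 ≤ domSize q
bistar₁₁-lowerBound q sudoku with free? (q fzero)
... | no centre₀-coloured = restrict-≤-domSize (ExceptLabel? 1) (bistarColour 1 ∘ toℕ) q coloured
  where
  coloured : ∀ v → toℕ v ≢ 1 → q v ≢ nothing
  coloured fzero           _   = centre₀-coloured
  coloured (fsuc fzero)    v≢1 = contradiction refl v≢1
  coloured (fsuc (fsuc i)) _   = bistar-leaf-coloured sudoku i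
... | yes centre₀-free = restrict-≤-domSize (ExceptLabel? 0) (bistarColour 1 ∘ toℕ) q coloured
  where
  centre₀-neighbours : ∀ {z} → Adj (Bistar 1 1) fzero z → toℕ z ≡ 1 ⊎ toℕ z ≡ 2
  centre₀-neighbours a with adj-fromRel {E = bistarE 1} a
  ... | inj₁ (inj₁ (_ , z≡1))                 = inj₁ z≡1
  ... | inj₁ (inj₂ (inj₁ (_ , 2≤z , z<3)))   = inj₂ (≤-antisym (≤-pred z<3) 2≤z)
  ... | inj₂ (inj₂ (inj₁ (_ , () , _)))
  ... | inj₂ (inj₂ (inj₂ (_ , ())))
  centre₁-neighbours : ∀ {z} → Adj (Bistar 1 1) (fsuc fzero) z → toℕ z ≡ 0 ⊎ toℕ z ≡ 3
  centre₁-neighbours {z} a with adj-fromRel {E = bistarE 1} a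
  ... | inj₁ (inj₂ (inj₂ (_ , 3≤z)))          = inj₂ (≤-antisym (≤-pred (toℕ<n z)) 3≤z)
  ... | inj₂ (inj₁ (z≡0 , _))                 = inj₁ z≡0
  ... | inj₂ (inj₂ (inj₁ (_ , s≤s () , _)))
  ... | inj₂ (inj₂ (inj₂ (_ , s≤s ())))
  coloured : ∀ v → toℕ v ≢ 0 → q v ≢ nothing
  coloured fzero           v≢0 = contradiction refl v≢0
  coloured (fsuc fzero)    _   =
    ¬free-edge-of-atMostTwoNeighbours sudoku (inj₁ (inj₁ (refl , refl)))
      (atMostTwoNeighbours-byLabels {G = Bistar 1 1} 1 2 centre₀-neighbours)
      (atMostTwoNeighbours-byLabels {G = Bistar 1 1} 0 3 centre₁-neighbours) centre₀-free
  coloured (fsuc (fsuc i)) _   = bistar-leaf-coloured sudoku i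

bistar₁₁-sudokuNumber : IsSudokuNumber (Bistar 1 1) 3 3
bistar₁₁-sudokuNumber =
  isSudokuNumber bistar-proper (restrict-extends (ExceptLabel? 1) (bistarColour 1 ∘ toℕ))
    (restrict-determines (ExceptLabel? 1) bistar-proper bistar₁₁-forced) refl bistar₁₁-lowerBound

mainTheorem1 :
    (∀ (n : ℕ) → 1 ≤ n → IsSudokuNumber (Path n) 3 ⌈ suc n /2⌉)
    × ((∀ (n : ℕ) → 2 ≤ n → IsSudokuNumber (Cycle (n + n)) 3 n)
    × ((∀ (n : ℕ) → 2 ≤ n → IsSudokuNumber (Star n) 3 n)
    × ((∀ (m n : ℕ) → 2 ≤ m → m ≤ n → IsSudokuNumber (CompleteBipartite m n) 3 m)
    × ((∀ (m n : ℕ) → 1 ≤ m → 1 ≤ n → (m ≡ 1 × n ≡ 1) → IsSudokuNumber (Bistar m n) 3 3)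
    × (∀ (m n : ℕ) → 1 ≤ m → 1 ≤ n → ¬ (m ≡ 1 × n ≡ 1) → IsSudokuNumber (Bistar m n) 3 (m + n))))))
mainTheorem1 =
  path-sudokuNumber , cycle-sudokuNumber , star-sudokuNumber , completeBipartite-sudokuNumber ,
  bistar₁₁ , bistar-sudokuNumber
  where
  bistar₁₁ : ∀ m n → 1 ≤ m → 1 ≤ n → (m ≡ 1 × n ≡ 1) → IsSudokuNumber (Bistar m n) 3 3
  bistar₁₁ _ _ _ _ (refl , refl) = bistar₁₁-sudokuNumber
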